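{- Let $m\ge 1$ and let $B$ be a symmetric bilinear form on $\mathbb{F}_2^{\;m}$. Let $G=\{(x,y): x\in\mathbb{F}_2^{\;m},\ y\in\mathbb{F}_2\}$ be the abelian group with operation $(x,y)\ast(x',y')=(x+x',\, y+y'+B(x,x'))$, and let $N=\{(0,y): y\in\mathbb{F}_2\}$. Let $R\subseteq G$. Then $R$ is a relative $(2^m,2,2^m,2^{m-1})$ difference set in $G$ relative to $N$ if and only if there is a function $f:\mathbb{F}_2^{\;m}\to\mathbb{F}_2$ such that, for every $b\in\mathbb{F}_2$ and every nonzero $a\in\mathbb{F}_2^{\;m}$, the equation \[ f(x+a)+f(x)+B(a,x)=b \] has exactly $2^{m-1}$ solutions $x\in\mathbb{F}_2^{\;m}$, and \[ R=\{(x,f(x)) : x\in\mathbb{F}_2^{\;m}\}. \]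
   Context: Let $G$ be a group (operation $\ast$) of order $mn$ containing a subgroup $N$ of order $n$. A $k$-subset $R$ of $G$ is a relative $(m,n,k,\lambda)$ difference set in $G$ relative to $N$ if the list of elements $r\ast r'^{ -1}$ with $r,r'\in R$, $r\neq r'$, contains every element of $G\setminus N$ exactly $\lambda$ times and contains no element of $N$. -}

module Defs where

open import Data.Bool using (Bool; true; false; _xor_; T; T?)
open import Data.Nat using (ℕ; _*_)
open import Level using (0ℓ) renaming (zero to lzero)
open import Data.List using (List; []; _∷_; _++_; map; length; filter; cartesianProduct)
open import Data.Vec using (Vec; []; _∷_; zipWith; replicate)
open import Data.Product using (_×_; _,_; proj₁; proj₂; ∃-syntax)
open import Relation.Nullary using (¬_; Dec; yes; no)
open import Relation.Nullary.Decidable using (¬?; _×-dec_)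
open import Relation.Unary using (Pred; Decidable)
open import Relation.Binary using (DecidableEquality)
open import Relation.Binary.PropositionalEquality using (_≡_)
import Data.Bool.Properties as BP
import Data.Vec.Properties as VP
import Data.Product.Properties as PP

F2^ : ℕ → Set
F2^ m = Vec Bool m

infixl 6 _⊕_
_⊕_ : ∀ {m} → F2^ m → F2^ m → F2^ m
_⊕_ = zipWith _xor_

𝟎 : ∀ {m} → F2^ m
𝟎 = replicate _ false

_≟v_ : ∀ {m} → DecidableEquality (F2^ m)
_≟v_ = VP.≡-dec BP._≟_

allVecs : (m : ℕ) → List (F2^ m)
allVecs ℕ.zero = [] ∷ []
allVecs (ℕ.suc m) = map (false ∷_) (allVecs m) ++ map (true ∷_) (allVecs m)

count : ∀ {A : Set} {P : Pred A lzero} → Decidable P → List A → ℕ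
count P? xs = length (filter P? xs)

-- symmetric bilinear form on F₂^m (F₂-linearity = additivity over F₂)
record SymBilinear (m : ℕ) (B : F2^ m → F2^ m → Bool) : Set where
  field
    additiveˡ : ∀ x x' z → B (x ⊕ x') z ≡ (B x z xor B x' z)
    symmetric : ∀ x z → B x z ≡ B z x

G : ℕ → Set
G m = F2^ m × Bool

module _ {m : ℕ} (B : F2^ m → F2^ m → Bool) where
  op : G m → G m → G m
  op (x , y) (x' , y') = (x ⊕ x' , (y xor y') xor B x x')

  -- inverse in G: (x,y)*(x, y + B(x,x)) = (0, 0)
  inv : G m → G m
  inv (x , y) = (x , y xor B x x)

allG : (m : ℕ) → List (G m)
allG m = cartesianProduct (allVecs m) (true ∷ false ∷ [])

_≟G_ : ∀ {m} → DecidableEquality (G m)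
_≟G_ = PP.≡-dec _≟v_ BP._≟_

InN : ∀ {m} → G m → Set
InN (x , _) = x ≡ 𝟎

InN? : ∀ {m} → Decidable (InN {m})
InN? (x , _) = x ≟v 𝟎

-- Generic relative (M, n, k, λ) difference set in a finite group given by
-- its list of elements (each exactly once), operation, inverse, and a
-- decidable subgroup N.
record IsRelDiffSet {A : Set} (elems : List A) (_≟_ : DecidableEquality A)
    (_∙_ : A → A → A) (_⁻¹ : A → A) (N : Pred A lzero) (N? : Decidable N)
    (M n k λ' : ℕ) (R : A → Bool) : Set where
  diffCount : A → ℕ
  diffCount g = count (λ p → (T? (R (proj₁ p)) ×-dec T? (R (proj₂ p)))
                              ×-dec (¬? (proj₁ p ≟ proj₂ p) ×-dec ((proj₁ p ∙ (proj₂ p ⁻¹)) ≟ g)))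
                      (cartesianProduct elems elems)
  field
    orderG : length elems ≡ M * n
    orderN : count N? elems ≡ n
    size   : count (λ g → T? (R g)) elems ≡ k
    offN   : ∀ g → ¬ N g → diffCount g ≡ λ'
    onN    : ∀ g → N g → diffCount g ≡ 0

-- Two points of a relative difference set R in the same fibre {x} × F₂ would have
-- their quotient in N, so R meets each of the 2^m fibres at most once; since
-- |R| = 2^m it is the graph of f x = R (x, 1). Conversely, for R the graph of f,
-- left additivity of B gives
--   (x + a, f (x + a)) ∗ (x, f x)⁻¹ = (a, f (x + a) + f x + B(a, x)),
-- so equal first coordinates force equal points (no quotient in N), and for a ≠ 0
-- the representations of (a, b) correspond to the solutions x of
-- f (x + a) + f x + B(a, x) = b.
module Submission where

open import Defs
open import Algebra.Bundles using (CommutativeMonoid)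
import Algebra.Properties.CommutativeSemigroup as CommSemigroupProperties
open import Data.Bool using (Bool; true; false; _xor_; T; _∧_; not)
open import Data.Bool.Properties using (_≟_; xor-assoc; xor-comm; xor-same; xor-identityʳ; ∧-identityʳ; ∧-zeroʳ; ∧-commutativeMonoid; T-≡; ⇔→≡)
open import Data.Empty using (⊥-elim)
open import Data.List using (List; []; _∷_; _++_; map; length; cartesianProduct)
open import Data.List.Membership.Propositional using (_∈_)
open import Data.List.Membership.Propositional.Properties using (∈-map⁺; ∈-++⁺ˡ; ∈-++⁺ʳ; ∈-filter⁺; ∈-cartesianProduct⁺)
open import Data.List.Properties using (map-++; map-∘; map-cong; length-++; length-map)
open import Data.List.Relation.Unary.Any using (here; there)
open import Data.Nat using (ℕ; zero; suc; _+_; _*_; _≤_; _^_; _∸_; z≤n; s≤s)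
open import Data.Nat.ListAction using (sum)
open import Data.Nat.ListAction.Properties using (sum-++)
open import Data.Nat.Properties using (+-identityʳ; +-mono-≤; +-commutativeSemigroup; suc-injective; 1+n≰n)
open import Data.Product using (_×_; _,_; Σ; ∃-syntax; proj₁; proj₂)
open import Data.Unit using (tt)
open import Data.Vec using ([]; _∷_)
import Data.Vec.Properties as Vec
open import Function.Base using (_∘_)
open import Function.Bundles using (_⇔_; mk⇔; Equivalence)
import Function.Properties.Equivalence as ⇔
open import Level using () renaming (zero to lzero)
open import Relation.Binary.PropositionalEquality using (_≡_; _≢_; refl; sym; trans; cong; cong₂; subst; module ≡-Reasoning)
open import Relation.Nullary using (¬_; Dec; yes; no; does)
open import Relation.Nullary.Decidable using (dec-true; dec-false; does-⇔; ¬?; _×-dec_; T?)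
open import Relation.Unary using (Pred; Decidable)

private variable
  A C : Set
  m : ℕ

-- Sums over lists

toℕ : Bool → ℕ
toℕ false = 0
toℕ true  = 1

∑ : List A → (A → ℕ) → ℕ
∑ xs h = sum (map h xs)

syntax ∑ xs (λ x → e) = ∑[ x ∈ xs ] e

count≡∑ : {P : Pred A lzero} (P? : Decidable P) (xs : List A) →
  count P? xs ≡ ∑[ x ∈ xs ] toℕ (does (P? x))
count≡∑ P? []       = refl
count≡∑ P? (x ∷ xs) with does (P? x)
... | true  = cong suc (count≡∑ P? xs)
... | false = count≡∑ P? xs

count-witness≢0 : {P : Pred A lzero} (P? : Decidable P) {xs : List A} {x : A} →
  x ∈ xs → P x → count P? xs ≢ 0
count-witness≢0 P? x∈xs px = nonEmpty (∈-filter⁺ P? x∈xs px)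
  where
  nonEmpty : ∀ {x : A} {ys} → x ∈ ys → length ys ≢ 0
  nonEmpty (here _)  ()
  nonEmpty (there _) ()

∑-cong : (xs : List A) {h k : A → ℕ} → (∀ x → h x ≡ k x) → ∑ xs h ≡ ∑ xs k
∑-cong xs h≗k = cong sum (map-cong h≗k xs)

∑-zero : (xs : List A) {h : A → ℕ} → (∀ x → h x ≡ 0) → ∑ xs h ≡ 0
∑-zero []       h≗0 = refl
∑-zero (x ∷ xs) h≗0 = cong₂ _+_ (h≗0 x) (∑-zero xs h≗0)

∑-+ : (xs : List A) (h k : A → ℕ) → ∑[ x ∈ xs ] (h x + k x) ≡ ∑ xs h + ∑ xs k
∑-+ []       h k = refl
∑-+ (x ∷ xs) h k = trans (cong (h x + k x +_) (∑-+ xs h k))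
  (CommSemigroupProperties.interchange +-commutativeSemigroup (h x) (k x) (∑ xs h) (∑ xs k))

∑-++ : (xs ys : List A) (h : A → ℕ) → ∑ (xs ++ ys) h ≡ ∑ xs h + ∑ ys h
∑-++ xs ys h = trans (cong sum (map-++ h xs ys)) (sum-++ (map h xs) (map h ys))

∑-map : (g : A → C) (xs : List A) (h : C → ℕ) → ∑ (map g xs) h ≡ ∑[ x ∈ xs ] h (g x)
∑-map g xs h = cong sum (sym (map-∘ xs))

∑-cartesianProduct : (xs : List A) (ys : List C) (h : A × C → ℕ) →
  ∑ (cartesianProduct xs ys) h ≡ ∑[ x ∈ xs ] ∑[ y ∈ ys ] h (x , y)
∑-cartesianProduct []       ys h = refl
∑-cartesianProduct (x ∷ xs) ys h =
  trans (∑-++ (map (x ,_) ys) (cartesianProduct xs ys) h)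
        (cong₂ _+_ (∑-map (x ,_) ys h) (∑-cartesianProduct xs ys h))

∑-comm : (xs : List A) (ys : List C) (h : A → C → ℕ) →
  ∑[ x ∈ xs ] ∑[ y ∈ ys ] h x y ≡ ∑[ y ∈ ys ] ∑[ x ∈ xs ] h x y
∑-comm []       ys h = sym (∑-zero ys (λ _ → refl))
∑-comm (x ∷ xs) ys h = trans (cong (∑ ys (h x) +_) (∑-comm xs ys h))
  (sym (∑-+ ys (h x) (λ y → ∑[ x ∈ xs ] h x y)))

length≡∑1 : (xs : List A) → length xs ≡ ∑[ x ∈ xs ] 1
length≡∑1 []       = refl
length≡∑1 (x ∷ xs) = cong suc (length≡∑1 xs)

length-cartesianProduct : (xs : List A) (ys : List C) →
  length (cartesianProduct xs ys) ≡ length xs * length ys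
length-cartesianProduct []       ys = refl
length-cartesianProduct (x ∷ xs) ys = trans (length-++ (map (x ,_) ys))
  (cong₂ _+_ (length-map (x ,_) ys) (length-cartesianProduct xs ys))

∑≤length : (xs : List A) {h : A → ℕ} → (∀ x → h x ≤ 1) → ∑ xs h ≤ length xs
∑≤length []       h≤1 = z≤n
∑≤length (x ∷ xs) h≤1 = +-mono-≤ (h≤1 x) (∑≤length xs h≤1)

∑≡length⇒≡1 : (xs : List A) {h : A → ℕ} → (∀ x → h x ≤ 1) →
  ∑ xs h ≡ length xs → ∀ {x} → x ∈ xs → h x ≡ 1
∑≡length⇒≡1 (y ∷ xs) {h} h≤1 ∑≡ x∈ with h y in hy | h≤1 y
... | zero          | _ = ⊥-elim (1+n≰n (subst (_≤ length xs) ∑≡ (∑≤length xs h≤1)))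
... | suc (suc _)   | s≤s ()
... | suc zero      | _ with x∈
...   | here refl   = hy
...   | there x∈xs  = ∑≡length⇒≡1 xs h≤1 (suc-injective ∑≡) x∈xs

-- The elementary abelian 2-group F₂^m

⊕-assoc : (x y z : F2^ m) → (x ⊕ y) ⊕ z ≡ x ⊕ (y ⊕ z)
⊕-assoc = Vec.zipWith-assoc xor-assoc

⊕-comm : (x y : F2^ m) → x ⊕ y ≡ y ⊕ x
⊕-comm = Vec.zipWith-comm xor-comm

⊕-identityʳ : (x : F2^ m) → x ⊕ 𝟎 ≡ x
⊕-identityʳ = Vec.zipWith-identityʳ xor-identityʳ

⊕-self : (x : F2^ m) → x ⊕ x ≡ 𝟎
⊕-self x = trans (cong (x ⊕_) (sym (Vec.map-id x))) (Vec.zipWith-inverseʳ xor-same x)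

⊕≡⇒≡⊕ : {x y a : F2^ m} → x ⊕ y ≡ a → x ≡ y ⊕ a
⊕≡⇒≡⊕ {x = x} {y} {a} e = begin
  x            ≡⟨ sym (⊕-identityʳ x) ⟩
  x ⊕ 𝟎        ≡⟨ cong (x ⊕_) (sym (⊕-self y)) ⟩
  x ⊕ (y ⊕ y)  ≡⟨ sym (⊕-assoc x y y) ⟩
  (x ⊕ y) ⊕ y  ≡⟨ cong (_⊕ y) e ⟩
  a ⊕ y        ≡⟨ ⊕-comm a y ⟩
  y ⊕ a        ∎
  where open ≡-Reasoning

⊕≡𝟎⇒≡ : {x y : F2^ m} → x ⊕ y ≡ 𝟎 → x ≡ y
⊕≡𝟎⇒≡ {y = y} e = trans (⊕≡⇒≡⊕ e) (⊕-identityʳ y)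

⊕-fixed⇒𝟎 : {x a : F2^ m} → x ⊕ a ≡ x → a ≡ 𝟎
⊕-fixed⇒𝟎 {x = x} {a} e = trans (⊕≡⇒≡⊕ (trans (⊕-comm a x) e)) (⊕-self x)

⊕-cancelʳ : (x a : F2^ m) → (x ⊕ a) ⊕ x ≡ a
⊕-cancelʳ x a = begin
  (x ⊕ a) ⊕ x  ≡⟨ cong (_⊕ x) (⊕-comm x a) ⟩
  (a ⊕ x) ⊕ x  ≡⟨ ⊕-assoc a x x ⟩
  a ⊕ (x ⊕ x)  ≡⟨ cong (a ⊕_) (⊕-self x) ⟩
  a ⊕ 𝟎        ≡⟨ ⊕-identityʳ a ⟩
  a            ∎
  where open ≡-Reasoning

allVecs-complete : (x : F2^ m) → x ∈ allVecs m
allVecs-complete []          = here refl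
allVecs-complete (false ∷ x) = ∈-++⁺ˡ (∈-map⁺ (false ∷_) (allVecs-complete x))
allVecs-complete (true ∷ x)  = ∈-++⁺ʳ _ (∈-map⁺ (true ∷_) (allVecs-complete x))

length-allVecs : (m : ℕ) → length (allVecs m) ≡ 2 ^ m
length-allVecs zero    = refl
length-allVecs (suc m) = begin
  length (map (false ∷_) (allVecs m) ++ map (true ∷_) (allVecs m))
    ≡⟨ length-++ (map (false ∷_) (allVecs m)) ⟩
  length (map (false ∷_) (allVecs m)) + length (map (true ∷_) (allVecs m))
    ≡⟨ cong₂ _+_ (length-map _ (allVecs m)) (length-map _ (allVecs m)) ⟩
  length (allVecs m) + length (allVecs m)
    ≡⟨ cong₂ _+_ (length-allVecs m) (trans (length-allVecs m) (sym (+-identityʳ (2 ^ m)))) ⟩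
  2 ^ m + (2 ^ m + 0) ∎
  where open ≡-Reasoning

∑-allVecs-single : (c : F2^ m) {h : F2^ m → ℕ} → (∀ x → x ≢ c → h x ≡ 0) → ∑ (allVecs m) h ≡ h c
∑-allVecs-single []          h≗0 = +-identityʳ _
∑-allVecs-single {suc m} (b ∷ c) {h} h≗0 =
  trans (∑-++ (map (false ∷_) (allVecs m)) (map (true ∷_) (allVecs m)) h)
        (trans (cong₂ _+_ (∑-map (false ∷_) (allVecs m) h) (∑-map (true ∷_) (allVecs m) h)) (halves b h≗0))
  where
  tail≢ : ∀ {b b' x} → x ≢ c → b' ∷ x ≢ b ∷ c
  tail≢ x≢c refl = x≢c refl
  halves : ∀ b → (∀ x → x ≢ b ∷ c → h x ≡ 0) →
    ∑[ x ∈ allVecs m ] h (false ∷ x) + ∑[ x ∈ allVecs m ] h (true ∷ x) ≡ h (b ∷ c)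
  halves false h≗0 = trans
    (cong₂ _+_ (∑-allVecs-single c (λ x x≢c → h≗0 _ (tail≢ x≢c))) (∑-zero (allVecs m) (λ x → h≗0 _ λ ())))
    (+-identityʳ _)
  halves true h≗0 =
    cong₂ _+_ (∑-zero (allVecs m) (λ x → h≗0 _ λ ())) (∑-allVecs-single c (λ x x≢c → h≗0 _ (tail≢ x≢c)))

T-does⇔ : {P : Set} (P? : Dec P) → T (does P?) ⇔ P
T-does⇔ (yes p) = mk⇔ (λ _ → p) (λ _ → tt)
T-does⇔ (no ¬p) = mk⇔ (λ ()) ¬p

T⇔T⇒≡ : {b c : Bool} → T b ⇔ T c → b ≡ c
T⇔T⇒≡ b⇔c = ⇔→≡ {z = true} (⇔.trans (⇔.sym T-≡) (⇔.trans b⇔c T-≡))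

≡⇒T⇔T : {b c : Bool} → b ≡ c → T b ⇔ T c
≡⇒T⇔T refl = ⇔.refl

not-does∧does : {P Q : Set} (P? : Dec P) (Q? : Dec Q) → (Q → P) → not (does P?) ∧ does Q? ≡ false
not-does∧does (yes _) Q? Q⇒P = refl
not-does∧does (no ¬p) Q? Q⇒P = dec-false Q? (¬p ∘ Q⇒P)

xor-cancel-middle : ∀ u v s t → (u xor (v xor s)) xor (s xor t) ≡ (u xor v) xor t
xor-cancel-middle u v s t = begin
  (u xor (v xor s)) xor (s xor t)  ≡⟨ cong (_xor (s xor t)) (sym (xor-assoc u v s)) ⟩
  ((u xor v) xor s) xor (s xor t)  ≡⟨ xor-assoc (u xor v) s (s xor t) ⟩
  (u xor v) xor (s xor (s xor t))  ≡⟨ cong ((u xor v) xor_) (sym (xor-assoc s s t)) ⟩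
  (u xor v) xor ((s xor s) xor t)  ≡⟨ cong (λ z → (u xor v) xor (z xor t)) (xor-same s) ⟩
  (u xor v) xor t                  ∎
  where open ≡-Reasoning

toℕ+toℕ≤1 : ∀ r r' → ¬ (T r × T r') → toℕ r + toℕ r' ≤ 1
toℕ+toℕ≤1 true  true  notBoth = ⊥-elim (notBoth (tt , tt))
toℕ+toℕ≤1 true  false _       = s≤s z≤n
toℕ+toℕ≤1 false true  _       = s≤s z≤n
toℕ+toℕ≤1 false false _       = z≤n

does-true≟ : ∀ r → does (true ≟ r) ≡ r
does-true≟ true  = refl
does-true≟ false = refl

exactlyOne⇒does-false≟ : ∀ r r' → ¬ (T r × T r') → toℕ r + toℕ r' ≡ 1 → does (false ≟ r) ≡ r'
exactlyOne⇒does-false≟ true  true  notBoth _ = ⊥-elim (notBoth (tt , tt))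
exactlyOne⇒does-false≟ true  false _       _ = refl
exactlyOne⇒does-false≟ false true  _       _ = refl
exactlyOne⇒does-false≟ false false _       ()

-- The group G and graphs of functions F₂^m → F₂

allG-complete : (g : G m) → g ∈ allG m
allG-complete (x , true)  = ∈-cartesianProduct⁺ (allVecs-complete x) (here refl)
allG-complete (x , false) = ∈-cartesianProduct⁺ (allVecs-complete x) (there (here refl))

length-allG : (m : ℕ) → length (allG m) ≡ 2 ^ m * 2
length-allG m = trans (length-cartesianProduct (allVecs m) _) (cong (_* 2) (length-allVecs m))

∑-allG : (h : G m → ℕ) → ∑ (allG m) h ≡ ∑[ x ∈ allVecs m ] (h (x , true) + h (x , false))
∑-allG {m} h = trans (∑-cartesianProduct (allVecs m) (true ∷ false ∷ []) h)
  (∑-cong (allVecs m) (λ x → cong (h (x , true) +_) (+-identityʳ _)))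

count-InN : count InN? (allG m) ≡ 2
count-InN {m} = begin
  count InN? (allG m)
    ≡⟨ trans (count≡∑ InN? (allG m)) (∑-allG {m} _) ⟩
  ∑[ x ∈ allVecs m ] (toℕ (does (x ≟v 𝟎)) + toℕ (does (x ≟v 𝟎)))
    ≡⟨ ∑-allVecs-single (𝟎 {m}) (λ x x≢𝟎 → cong (λ b → toℕ b + toℕ b) (dec-false (x ≟v 𝟎) x≢𝟎)) ⟩
  toℕ (does (𝟎 {m} ≟v 𝟎)) + toℕ (does (𝟎 {m} ≟v 𝟎))
    ≡⟨ cong (λ b → toℕ b + toℕ b) (dec-true (_≟v_ {m} 𝟎 𝟎) refl) ⟩
  2 ∎
  where open ≡-Reasoning

IsGraphOf : (F2^ m → Bool) → (G m → Bool) → Set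
IsGraphOf f R = ∀ x y → R (x , y) ≡ does (y ≟ f x)

isGraphOf⇔ : {f : F2^ m → Bool} {R : G m → Bool} →
  IsGraphOf f R ⇔ (∀ g → T (R g) ⇔ (∃[ x ] g ≡ (x , f x)))
isGraphOf⇔ {f = f} {R} = mk⇔
  (λ graph (x , y) → ⇔.trans (≡⇒T⇔T (graph x y)) (⇔.trans (T-does⇔ (y ≟ f x)) (⇔.sym onGraph)))
  (λ member x y → T⇔T⇒≡ (⇔.trans (member (x , y)) (⇔.trans onGraph (⇔.sym (T-does⇔ (y ≟ f x))))))
  where
  onGraph : ∀ {x y} → (∃[ x' ] (x , y) ≡ (x' , f x')) ⇔ y ≡ f x
  onGraph {x} = mk⇔ (λ { (_ , refl) → refl }) (λ { refl → x , refl })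

∑-graph : {f : F2^ m → Bool} {R : G m → Bool} → IsGraphOf f R → (φ : G m → Bool) →
  ∑[ p ∈ allG m ] toℕ (R p ∧ φ p) ≡ ∑[ x ∈ allVecs m ] toℕ (φ (x , f x))
∑-graph {m} {f} {R} graph φ = trans (∑-allG {m} _) (∑-cong (allVecs m) fibre)
  where
  fibre : ∀ x → toℕ (R (x , true) ∧ φ (x , true)) + toℕ (R (x , false) ∧ φ (x , false)) ≡ toℕ (φ (x , f x))
  fibre x rewrite graph x true | graph x false with f x
  ... | true  = +-identityʳ _
  ... | false = refl

count-graph : {f : F2^ m → Bool} {R : G m → Bool} → IsGraphOf f R → count (λ g → T? (R g)) (allG m) ≡ 2 ^ m
count-graph {m} {R = R} graph = begin
  count (λ g → T? (R g)) (allG m)    ≡⟨ count≡∑ (λ g → T? (R g)) (allG m) ⟩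
  ∑[ p ∈ allG m ] toℕ (R p)          ≡⟨ ∑-cong (allG m) (λ p → cong toℕ (sym (∧-identityʳ (R p)))) ⟩
  ∑[ p ∈ allG m ] toℕ (R p ∧ true)   ≡⟨ ∑-graph graph (λ _ → true) ⟩
  ∑[ x ∈ allVecs m ] 1               ≡⟨ sym (length≡∑1 (allVecs m)) ⟩
  length (allVecs m)                 ≡⟨ length-allVecs m ⟩
  2 ^ m                              ∎
  where open ≡-Reasoning

-- Relative difference sets in G

module _ (B : F2^ m → F2^ m → Bool) where

  distinctWithQuotient : G m → G m → G m → Bool
  distinctWithQuotient g p q = not (does (p ≟G q)) ∧ does (op B p (inv B q) ≟G g)

  op-inv-shift : (∀ x x' z → B (x ⊕ x') z ≡ (B x z xor B x' z)) →
    (x a : F2^ m) (u v : Bool) → op B (x ⊕ a , u) (inv B (x , v)) ≡ (a , (u xor v) xor B a x)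
  op-inv-shift additiveˡ x a u v = cong₂ _,_ (⊕-cancelʳ x a) (begin
    (u xor (v xor B x x)) xor B (x ⊕ a) x      ≡⟨ cong ((u xor (v xor B x x)) xor_) (additiveˡ x a x) ⟩
    (u xor (v xor B x x)) xor (B x x xor B a x) ≡⟨ xor-cancel-middle u v (B x x) (B a x) ⟩
    (u xor v) xor B a x                         ∎)
    where open ≡-Reasoning

  module _ (R : G m → Bool) where

    isDifference? : (g : G m) → Decidable (λ (p : G m × G m) →
      (T (R (proj₁ p)) × T (R (proj₂ p))) × (proj₁ p ≢ proj₂ p × op B (proj₁ p) (inv B (proj₂ p)) ≡ g))
    isDifference? g p = (T? (R (proj₁ p)) ×-dec T? (R (proj₂ p)))
                        ×-dec (¬? (proj₁ p ≟G proj₂ p) ×-dec (op B (proj₁ p) (inv B (proj₂ p)) ≟G g))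

    -- Definitionally IsRelDiffSet.diffCount, which is only reachable through a record value.
    differenceCount : G m → ℕ
    differenceCount g = count (isDifference? g) (cartesianProduct (allG m) (allG m))

    differenceCount-graph : {f : F2^ m → Bool} → IsGraphOf f R → (g : G m) →
      differenceCount g ≡ ∑[ x' ∈ allVecs m ] ∑[ x ∈ allVecs m ] toℕ (distinctWithQuotient g (x , f x) (x' , f x'))
    differenceCount-graph {f} graph g = begin
      differenceCount g
        ≡⟨ trans (count≡∑ (isDifference? g) (cartesianProduct (allG m) (allG m))) (∑-cartesianProduct (allG m) (allG m) _) ⟩
      ∑[ p ∈ allG m ] ∑[ q ∈ allG m ] toℕ ((R p ∧ R q) ∧ distinctWithQuotient g p q)
        ≡⟨ ∑-cong (allG m) (λ p → ∑-cong (allG m) (λ q → cong toℕ (∧-middle (R p) (R q) _))) ⟩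
      ∑[ p ∈ allG m ] ∑[ q ∈ allG m ] toℕ (R q ∧ (R p ∧ distinctWithQuotient g p q))
        ≡⟨ ∑-cong (allG m) (λ p → ∑-graph graph _) ⟩
      ∑[ p ∈ allG m ] ∑[ x' ∈ allVecs m ] toℕ (R p ∧ distinctWithQuotient g p (x' , f x'))
        ≡⟨ ∑-comm (allG m) (allVecs m) _ ⟩
      ∑[ x' ∈ allVecs m ] ∑[ p ∈ allG m ] toℕ (R p ∧ distinctWithQuotient g p (x' , f x'))
        ≡⟨ ∑-cong (allVecs m) (λ x' → ∑-graph graph _) ⟩
      ∑[ x' ∈ allVecs m ] ∑[ x ∈ allVecs m ] toℕ (distinctWithQuotient g (x , f x) (x' , f x')) ∎
      where
      open ≡-Reasoning
      ∧-middle = CommSemigroupProperties.xy∙z≈y∙xz (CommutativeMonoid.commutativeSemigroup ∧-commutativeMonoid)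

    differenceCount-N : {f : F2^ m → Bool} → IsGraphOf f R → ∀ b → differenceCount (𝟎 , b) ≡ 0
    differenceCount-N {f} graph b = trans (differenceCount-graph graph (𝟎 , b))
      (∑-zero (allVecs m) λ x' → ∑-zero (allVecs m) λ x → cong toℕ
        (not-does∧does ((x , f x) ≟G (x' , f x')) (op B (x , f x) (inv B (x' , f x')) ≟G (𝟎 , b))
          (λ e → cong (λ z → z , f z) (⊕≡𝟎⇒≡ (cong proj₁ e)))))

    differenceCount-outsideN : (∀ x x' z → B (x ⊕ x') z ≡ (B x z xor B x' z)) →
      {f : F2^ m → Bool} → IsGraphOf f R → ∀ {a} b → a ≢ 𝟎 →
      differenceCount (a , b) ≡ count (λ x → ((f (x ⊕ a) xor f x) xor B a x) ≟ b) (allVecs m)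
    differenceCount-outsideN additiveˡ {f} graph {a} b a≢𝟎 = begin
      differenceCount (a , b)
        ≡⟨ differenceCount-graph graph (a , b) ⟩
      ∑[ x' ∈ allVecs m ] ∑[ x ∈ allVecs m ] toℕ (distinctWithQuotient (a , b) (x , f x) (x' , f x'))
        ≡⟨ ∑-cong (allVecs m) (λ x' → ∑-allVecs-single (x' ⊕ a) (offShift x')) ⟩
      ∑[ x' ∈ allVecs m ] toℕ (distinctWithQuotient (a , b) (x' ⊕ a , f (x' ⊕ a)) (x' , f x'))
        ≡⟨ ∑-cong (allVecs m) (cong toℕ ∘ atShift) ⟩
      ∑[ x ∈ allVecs m ] toℕ (does (((f (x ⊕ a) xor f x) xor B a x) ≟ b))
        ≡⟨ sym (count≡∑ (λ x → ((f (x ⊕ a) xor f x) xor B a x) ≟ b) (allVecs m)) ⟩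
      count (λ x → ((f (x ⊕ a) xor f x) xor B a x) ≟ b) (allVecs m) ∎
      where
      open ≡-Reasoning
      offShift : ∀ x' x → x ≢ x' ⊕ a → toℕ (distinctWithQuotient (a , b) (x , f x) (x' , f x')) ≡ 0
      offShift x' x x≢ = cong toℕ (trans
        (cong (not (does ((x , f x) ≟G (x' , f x'))) ∧_)
              (dec-false (op B (x , f x) (inv B (x' , f x')) ≟G (a , b)) (λ e → x≢ (⊕≡⇒≡⊕ (cong proj₁ e)))))
        (∧-zeroʳ _))
      atShift : ∀ x → distinctWithQuotient (a , b) (x ⊕ a , f (x ⊕ a)) (x , f x)
                      ≡ does (((f (x ⊕ a) xor f x) xor B a x) ≟ b)
      atShift x = cong₂ _∧_
        (cong not (dec-false ((x ⊕ a , f (x ⊕ a)) ≟G (x , f x)) (λ e → a≢𝟎 (⊕-fixed⇒𝟎 (cong proj₁ e)))))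
        (does-⇔ (mk⇔ (λ e → cong proj₂ (trans (sym shift) e)) (λ e → trans shift (cong (a ,_) e)))
                (op B (x ⊕ a , f (x ⊕ a)) (inv B (x , f x)) ≟G (a , b)) (((f (x ⊕ a) xor f x) xor B a x) ≟ b))
        where shift = op-inv-shift additiveˡ x a (f (x ⊕ a)) (f x)

    rds-fibre-atMostOne : ∀ {M n k λ'} →
      IsRelDiffSet (allG m) _≟G_ (op B) (inv B) InN InN? M n k λ' R →
      ∀ x → ¬ (T (R (x , true)) × T (R (x , false)))
    rds-fibre-atMostOne D x (r , r') = count-witness≢0 (isDifference? g₀)
      (∈-cartesianProduct⁺ (allG-complete (x , true)) (allG-complete (x , false)))
      ((r , r') , ((λ ()) , refl))
      (IsRelDiffSet.onN D g₀ (⊕-self x))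
      where g₀ = op B (x , true) (inv B (x , false))

    rds⇒graph : ∀ {M n λ'} →
      IsRelDiffSet (allG m) _≟G_ (op B) (inv B) InN InN? M n (2 ^ m) λ' R →
      IsGraphOf (λ x → R (x , true)) R
    rds⇒graph D x true  = sym (does-true≟ (R (x , true)))
    rds⇒graph D x false = sym (exactlyOne⇒does-false≟ _ _ (rds-fibre-atMostOne D x)
      (∑≡length⇒≡1 (allVecs m) fibreSize≤1 fibreSizes (allVecs-complete x)))
      where
      fibreSize≤1 : ∀ x → toℕ (R (x , true)) + toℕ (R (x , false)) ≤ 1
      fibreSize≤1 x = toℕ+toℕ≤1 _ _ (rds-fibre-atMostOne D x)
      fibreSizes : ∑[ x ∈ allVecs m ] (toℕ (R (x , true)) + toℕ (R (x , false))) ≡ length (allVecs m)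
      fibreSizes = begin
        ∑[ x ∈ allVecs m ] (toℕ (R (x , true)) + toℕ (R (x , false)))  ≡⟨ sym (∑-allG (toℕ ∘ R)) ⟩
        ∑[ g ∈ allG m ] toℕ (R g)                                        ≡⟨ sym (count≡∑ (λ g → T? (R g)) (allG m)) ⟩
        count (λ g → T? (R g)) (allG m)                                  ≡⟨ IsRelDiffSet.size D ⟩
        2 ^ m                                                            ≡⟨ sym (length-allVecs m) ⟩
        length (allVecs m)                                               ∎
        where open ≡-Reasoning

mainTheorem2 : (m : ℕ) → 1 ≤ m →
    (B : F2^ m → F2^ m → Bool) → SymBilinear m B →
    (R : G m → Bool) →
    IsRelDiffSet (allG m) _≟G_ (op B) (inv B) InN InN? (2 ^ m) 2 (2 ^ m) (2 ^ (m ∸ 1)) R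
    ⇔
    (Σ (F2^ m → Bool) λ f →
      ((b : Bool) (a : F2^ m) → ¬ a ≡ 𝟎 →
         count (λ x → ((f (x ⊕ a) xor f x) xor B a x) ≟ b) (allVecs m) ≡ 2 ^ (m ∸ 1))
      × ((g : G m) → T (R g) ⇔ (∃[ x ] g ≡ (x , f x))))
mainTheorem2 m _ B bil R = mk⇔
  (λ D → let graph = rds⇒graph B R D in
    (λ x → R (x , true)) ,
    (λ b a a≢𝟎 → trans (sym (differenceCount-outsideN B R additiveˡ graph b a≢𝟎))
                       (IsRelDiffSet.offN D (a , b) a≢𝟎)) ,
    Equivalence.to isGraphOf⇔ graph)
  (λ (f , solutionCounts , member) → let graph = Equivalence.from isGraphOf⇔ member in record
    { orderG = length-allG m
    ; orderN = count-InN {m}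
    ; size   = count-graph graph
    ; offN   = λ { (a , b) a≢𝟎 → trans (differenceCount-outsideN B R additiveˡ graph b a≢𝟎)
                                       (solutionCounts b a a≢𝟎) }
    ; onN    = λ { (_ , b) refl → differenceCount-N B R graph b }
    })
  where open SymBilinear bil
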